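{- Let $K$ be a real number field and suppose $\alpha_1,\dots,\alpha_n\in\mathfrak{O}_K^+$ generate $\mathfrak{O}_K$ as a $\mathbb{Z}$-module. If $\alpha\in\mathrm{SG}(\alpha_1,\dots,\alpha_n)$, then $\mathrm{Frob}(\alpha_1,\dots,\alpha_n,\alpha)=\mathrm{Frob}(\alpha_1,\dots,\alpha_n)$.
   Context: A real number field is a number field that is a subfield of $\mathbb{R}$; $\mathfrak{O}_K$ is its ring of integers and $\mathfrak{O}_K^+=\mathfrak{O}_K\cap[0,\infty)$. $\mathbb{N}=\{0,1,2,\dots\}$. For any finite list $\gamma_1,\dots,\gamma_k\in\mathfrak{O}_K^+$: $\mathrm{SG}(\gamma_1,\dots,\gamma_k)=\{\sum x_i\gamma_i\mid x_i\in\mathbb{N}\}$; $C_\mathbb{Q}(\gamma_1,\dots,\gamma_k)=\{\sum x_i\gamma_i\mid x_i\in\mathbb{Q}_{\geqslant0}\}$; $\mathrm{Frob}(\gamma_1,\dots,\gamma_k)=\{w\in\mathrm{SG}(\gamma_1,\dots,\gamma_k)\mid w+(C_\mathbb{Q}(\gamma_1,\dots,\gamma_k)\cap\mathfrak{O}_K)\subseteq \mathrm{SG}(\gamma_1,\dots,\gamma_k)\}$. -}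

module Defs where

open import Level using (0ℓ)
open import Data.Nat as ℕ using (ℕ; zero; suc)
open import Data.Integer as ℤ using (ℤ; +_; -[1+_])
open import Data.Rational as ℚ using (ℚ)
open import Data.Fin using (Fin; zero; suc; toℕ)
open import Data.Product using (Σ; ∃; _×_; _,_)
open import Relation.Binary.PropositionalEquality using (_≡_)
open import Relation.Binary.Structures using (IsTotalOrder)
open import Relation.Nullary using (¬_)
open import Algebra.Structures using (IsCommutativeRing)
open import Function.Bundles using (_⇔_)

snoc : ∀ {A : Set} {n : ℕ} → (Fin n → A) → A → Fin (suc n) → A
snoc {n = zero}  γ a zero    = a
snoc {n = suc n} γ a zero    = γ zero
snoc {n = suc n} γ a (suc i) = snoc (λ j → γ (suc j)) a i

-- A real number field, presented abstractly: a field (equality is ≡) with a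
-- total order compatible with + and *, which is Archimedean (so it embeds,
-- order-preservingly and uniquely, as a subfield of ℝ) and finite-dimensional
-- over its prime field ℚ.  The order is the one induced from ℝ.
record OrderedField : Set₁ where
  infixl 7 _*_
  infixl 6 _+_
  infix 4 _≤_
  field
    Carrier : Set
    _+_ _*_ : Carrier → Carrier → Carrier
    -_ : Carrier → Carrier
    0# 1# : Carrier
    isCommutativeRing : IsCommutativeRing _≡_ _+_ _*_ -_ 0# 1#
    _⁻¹ : Carrier → Carrier
    0≢1 : ¬ (0# ≡ 1#)
    ⁻¹-inverse : ∀ x → ¬ (x ≡ 0#) → x * (x ⁻¹) ≡ 1#
    _≤_ : Carrier → Carrier → Set
    isTotalOrder : IsTotalOrder _≡_ _≤_
    +-mono-≤ : ∀ {x y} z → x ≤ y → x + z ≤ y + z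
    *-nonneg : ∀ {x y} → 0# ≤ x → 0# ≤ y → 0# ≤ x * y

module OrderedFieldOps (F : OrderedField) where
  open OrderedField F

  fromℕ′ : ℕ → Carrier
  fromℕ′ zero    = 0#
  fromℕ′ (suc n) = 1# + fromℕ′ n

  fromℤ : ℤ → Carrier
  fromℤ (+ n)     = fromℕ′ n
  fromℤ -[1+ n ]  = - (fromℕ′ (suc n))

  fromℚ : ℚ → Carrier
  fromℚ q = fromℤ (ℚ.numerator q) * (fromℕ′ (ℚ.denominatorℕ q)) ⁻¹

  Σ[_] : ∀ {n} → (Fin n → Carrier) → Carrier
  Σ[_] {zero}  f = 0#
  Σ[_] {suc n} f = f zero + Σ[_] (λ i → f (suc i))

  pow : Carrier → ℕ → Carrier
  pow x zero    = 1#
  pow x (suc k) = x * pow x k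

record RealNumberField : Set₁ where
  field
    orderedField : OrderedField
  open OrderedField orderedField public
  open OrderedFieldOps orderedField public
  field
    archimedean : ∀ x → ∃ λ (n : ℕ) → x ≤ fromℕ′ n
    finiteDim : ∃ λ (d : ℕ) → Σ (Fin d → Carrier) λ b →
                  ∀ x → Σ (Fin d → ℚ) λ q → x ≡ Σ[ (λ i → fromℚ (q i) * b i) ]

module _ (K : RealNumberField) where
  open RealNumberField K

  IsIntegral : Carrier → Set
  IsIntegral x = ∃ λ (d : ℕ) → Σ (Fin d → ℤ) λ c →
    pow x d + Σ[ (λ i → fromℤ (c i) * pow x (toℕ i)) ] ≡ 0#

  IsIntegral⁺ : Carrier → Set
  IsIntegral⁺ x = IsIntegral x × (0# ≤ x)

  GeneratesIntegers : ∀ {n} → (Fin n → Carrier) → Set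
  GeneratesIntegers {n} α =
    (∀ i → IsIntegral (α i)) ×
    (∀ x → IsIntegral x → Σ (Fin n → ℤ) λ z → x ≡ Σ[ (λ i → fromℤ (z i) * α i) ])

  InSG : ∀ {k} → (Fin k → Carrier) → Carrier → Set
  InSG {k} γ w = Σ (Fin k → ℕ) λ x → w ≡ Σ[ (λ i → fromℕ′ (x i) * γ i) ]

  InCone : ∀ {k} → (Fin k → Carrier) → Carrier → Set
  InCone {k} γ w = Σ (Fin k → ℚ) λ x → (∀ i → ℚ.0ℚ ℚ.≤ x i) × (w ≡ Σ[ (λ i → fromℚ (x i) * γ i) ])

  InFrob : ∀ {k} → (Fin k → Carrier) → Carrier → Set
  InFrob γ w = InSG γ w × (∀ v → InCone γ v → IsIntegral v → InSG γ (w + v))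

{-# OPTIONS --safe #-}
module Submission where

-- If a = Σ yᵢ αᵢ with yᵢ ∈ ℕ, then any combination c₁α₁ + … + cₙαₙ + c a equals
-- Σ (cᵢ + c yᵢ) αᵢ, with coefficients in ℕ (resp. ℚ≥0) whenever the cᵢ and c are.
-- Hence appending a changes neither the semigroup nor the rational cone, and
-- Frob depends only on these two sets.

open import Defs
open import Data.Nat using (ℕ)
open import Data.Fin using (Fin)
open import Function.Bundles using (_⇔_; mk⇔; Equivalence)

open import Data.Nat as ℕ using (zero; suc)
open import Data.Integer as ℤ using (-[1+_])
import Data.Integer.Properties as ℤ
open import Data.Rational as ℚ using (ℚ; mkℚ; 0ℚ)
import Data.Rational.Properties as ℚ
open import Data.Rational.Unnormalised as ℚᵘ using (mkℚᵘ; *≡*)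
import Data.Rational.Unnormalised.Properties as ℚᵘ
open import Data.Nat.Coprimality as Coprime using (1-coprimeTo)
open import Data.Fin using (inject₁; fromℕ)
open import Data.Product using (_,_)
open import Data.Sum using (inj₁; inj₂)
open import Data.Empty using (⊥-elim)
open import Data.Maybe using (nothing)
open import Relation.Binary.PropositionalEquality
open import Relation.Binary.Structures using (IsTotalOrder)
open import Relation.Nullary using (¬_)
open import Algebra.Structures using (IsCommutativeRing)
open import Tactic.RingSolver.Core.AlmostCommutativeRing using (AlmostCommutativeRing; fromCommutativeRing)

snoc-inject₁ : ∀ {A : Set} {n} (γ : Fin n → A) a i → snoc γ a (inject₁ i) ≡ γ i
snoc-inject₁ {n = suc n} γ a Fin.zero    = refl
snoc-inject₁ {n = suc n} γ a (Fin.suc i) = snoc-inject₁ (λ j → γ (Fin.suc j)) a i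

snoc-last : ∀ {A : Set} {n} (γ : Fin n → A) a → snoc γ a (fromℕ n) ≡ a
snoc-last {n = zero}  γ a = refl
snoc-last {n = suc n} γ a = snoc-last (λ j → γ (Fin.suc j)) a

snoc-all : ∀ {A : Set} (P : A → Set) {n} {γ : Fin n → A} {a} →
           (∀ i → P (γ i)) → P a → ∀ j → P (snoc γ a j)
snoc-all P {zero}  Pγ Pa Fin.zero    = Pa
snoc-all P {suc n} Pγ Pa Fin.zero    = Pγ Fin.zero
snoc-all P {suc n} Pγ Pa (Fin.suc j) = snoc-all P (λ i → Pγ (Fin.suc i)) Pa j

0≤-+ : ∀ {p q} → 0ℚ ℚ.≤ p → 0ℚ ℚ.≤ q → 0ℚ ℚ.≤ p ℚ.+ q
0≤-+ {p} {q} 0≤p 0≤q = ℚ.nonNegative⁻¹ _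
  {{ℚ.nonNeg+nonNeg⇒nonNeg p {{ℚ.nonNegative 0≤p}} q {{ℚ.nonNegative 0≤q}}}}

0≤-* : ∀ {p q} → 0ℚ ℚ.≤ p → 0ℚ ℚ.≤ q → 0ℚ ℚ.≤ p ℚ.* q
0≤-* {p} {q} 0≤p 0≤q = ℚ.nonNegative⁻¹ _
  {{ℚ.nonNeg*nonNeg⇒nonNeg p {{ℚ.nonNegative 0≤p}} q {{ℚ.nonNegative 0≤q}}}}

0≰-[1+_] : ∀ {p} m → ℚ.numerator p ≡ -[1+ m ] → ¬ (0ℚ ℚ.≤ p)
0≰-[1+_] {mkℚ _ _ _} m refl 0≤p = ℤ.NonNegative.nonNeg (ℚ.nonNegative 0≤p)

ℕ→ℚ : ℕ → ℚ
ℕ→ℚ y = mkℚ (ℤ.+ y) 0 (Coprime.sym (1-coprimeTo y))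

0≤ℕ→ℚ : ∀ y → 0ℚ ℚ.≤ ℕ→ℚ y
0≤ℕ→ℚ y = ℚ.nonNegative⁻¹ (ℕ→ℚ y)

module OrderedFieldProperties (F : OrderedField) where
  open OrderedField F
  open OrderedFieldOps F
  open IsCommutativeRing isCommutativeRing
    using (+-assoc; +-comm; *-assoc; *-comm; distribˡ; distribʳ; zeroˡ; zeroʳ;
           +-identityˡ; +-identityʳ; *-identityˡ; *-identityʳ; -‿inverseˡ; -‿inverseʳ)
  open IsTotalOrder isTotalOrder using (total; antisym) renaming (refl to ≤-refl; trans to ≤-trans)
  open ≡-Reasoning

  ring : AlmostCommutativeRing _ _
  ring = fromCommutativeRing (record { isCommutativeRing = isCommutativeRing }) (λ _ → nothing)

  open import Tactic.RingSolver.NonReflective ring using (solve; _⊕_; _⊗_; _⊜_)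

  *-≢0 : ∀ {x y} → ¬ (x ≡ 0#) → ¬ (y ≡ 0#) → ¬ (x * y ≡ 0#)
  *-≢0 {x} {y} x≢0 y≢0 xy≡0 = x≢0 (begin
    x                ≡⟨ sym (*-identityʳ x) ⟩
    x * 1#           ≡⟨ cong (x *_) (sym (⁻¹-inverse y y≢0)) ⟩
    x * (y * y ⁻¹)   ≡⟨ sym (*-assoc x y (y ⁻¹)) ⟩
    (x * y) * y ⁻¹   ≡⟨ cong (_* y ⁻¹) xy≡0 ⟩
    0# * y ⁻¹        ≡⟨ zeroˡ _ ⟩
    0#               ∎)

  ⁻¹-unique : ∀ {x y} → ¬ (x ≡ 0#) → x * y ≡ 1# → y ≡ x ⁻¹
  ⁻¹-unique {x} {y} x≢0 xy≡1 = begin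
    y                ≡⟨ sym (*-identityʳ y) ⟩
    y * 1#           ≡⟨ cong (y *_) (sym (⁻¹-inverse x x≢0)) ⟩
    y * (x * x ⁻¹)   ≡⟨ sym (*-assoc y x (x ⁻¹)) ⟩
    (y * x) * x ⁻¹   ≡⟨ cong (_* x ⁻¹) (trans (*-comm y x) xy≡1) ⟩
    1# * x ⁻¹        ≡⟨ *-identityˡ _ ⟩
    x ⁻¹             ∎

  1⁻¹ : 1# ⁻¹ ≡ 1#
  1⁻¹ = sym (⁻¹-unique (λ 1≡0 → 0≢1 (sym 1≡0)) (*-identityʳ 1#))

  ⁻¹-* : ∀ {x y} → ¬ (x ≡ 0#) → ¬ (y ≡ 0#) → (x * y) ⁻¹ ≡ x ⁻¹ * y ⁻¹
  ⁻¹-* {x} {y} x≢0 y≢0 = sym (⁻¹-unique (*-≢0 x≢0 y≢0) (begin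
    (x * y) * (x ⁻¹ * y ⁻¹)   ≡⟨ interchange x y (x ⁻¹) (y ⁻¹) ⟩
    (x * x ⁻¹) * (y * y ⁻¹)   ≡⟨ cong₂ _*_ (⁻¹-inverse x x≢0) (⁻¹-inverse y y≢0) ⟩
    1# * 1#                   ≡⟨ *-identityˡ 1# ⟩
    1#                        ∎))
    where
    interchange : ∀ a b c d → (a * b) * (c * d) ≡ (a * c) * (b * d)
    interchange = solve 4 (λ a b c d → (a ⊗ b) ⊗ (c ⊗ d) ⊜ (a ⊗ c) ⊗ (b ⊗ d)) refl

  ÷-cong : ∀ {a b c d} → ¬ (b ≡ 0#) → ¬ (d ≡ 0#) → a * d ≡ c * b → a * b ⁻¹ ≡ c * d ⁻¹
  ÷-cong {a} {b} {c} {d} b≢0 d≢0 ad≡cb = begin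
    a * b ⁻¹                       ≡⟨ sym (*-identityʳ _) ⟩
    a * b ⁻¹ * 1#                  ≡⟨ cong (a * b ⁻¹ *_) (sym (⁻¹-inverse d d≢0)) ⟩
    a * b ⁻¹ * (d * d ⁻¹)          ≡⟨ solve 4 (λ a b' d d' → a ⊗ b' ⊗ (d ⊗ d') ⊜ (a ⊗ d) ⊗ (b' ⊗ d')) refl a (b ⁻¹) d (d ⁻¹) ⟩
    (a * d) * (b ⁻¹ * d ⁻¹)        ≡⟨ cong (_* (b ⁻¹ * d ⁻¹)) ad≡cb ⟩
    (c * b) * (b ⁻¹ * d ⁻¹)        ≡⟨ solve 4 (λ c b b' d' → (c ⊗ b) ⊗ (b' ⊗ d') ⊜ c ⊗ d' ⊗ (b ⊗ b')) refl c b (b ⁻¹) (d ⁻¹) ⟩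
    c * d ⁻¹ * (b * b ⁻¹)          ≡⟨ cong (c * d ⁻¹ *_) (⁻¹-inverse b b≢0) ⟩
    c * d ⁻¹ * 1#                  ≡⟨ *-identityʳ _ ⟩
    c * d ⁻¹                       ∎

  ÷-+ : ∀ {a b c d} → ¬ (b ≡ 0#) → ¬ (d ≡ 0#) →
        (a * d + c * b) * (b * d) ⁻¹ ≡ a * b ⁻¹ + c * d ⁻¹
  ÷-+ {a} {b} {c} {d} b≢0 d≢0 = begin
    (a * d + c * b) * (b * d) ⁻¹
      ≡⟨ cong ((a * d + c * b) *_) (⁻¹-* b≢0 d≢0) ⟩
    (a * d + c * b) * (b ⁻¹ * d ⁻¹)
      ≡⟨ solve 6 (λ a b c d b' d' → (a ⊗ d ⊕ c ⊗ b) ⊗ (b' ⊗ d') ⊜ (a ⊗ b' ⊗ (d ⊗ d') ⊕ c ⊗ d' ⊗ (b ⊗ b')))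
               refl a b c d (b ⁻¹) (d ⁻¹) ⟩
    a * b ⁻¹ * (d * d ⁻¹) + c * d ⁻¹ * (b * b ⁻¹)
      ≡⟨ cong₂ (λ u v → a * b ⁻¹ * u + c * d ⁻¹ * v) (⁻¹-inverse d d≢0) (⁻¹-inverse b b≢0) ⟩
    a * b ⁻¹ * 1# + c * d ⁻¹ * 1#
      ≡⟨ cong₂ _+_ (*-identityʳ _) (*-identityʳ _) ⟩
    a * b ⁻¹ + c * d ⁻¹ ∎

  ÷-* : ∀ {a b c d} → ¬ (b ≡ 0#) → ¬ (d ≡ 0#) → (a * c) * (b * d) ⁻¹ ≡ (a * b ⁻¹) * (c * d ⁻¹)
  ÷-* {a} {b} {c} {d} b≢0 d≢0 = begin
    (a * c) * (b * d) ⁻¹         ≡⟨ cong ((a * c) *_) (⁻¹-* b≢0 d≢0) ⟩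
    (a * c) * (b ⁻¹ * d ⁻¹)      ≡⟨ solve 4 (λ a c b' d' → (a ⊗ c) ⊗ (b' ⊗ d') ⊜ (a ⊗ b') ⊗ (c ⊗ d')) refl a c (b ⁻¹) (d ⁻¹) ⟩
    (a * b ⁻¹) * (c * d ⁻¹)      ∎

  0≤1 : 0# ≤ 1#
  0≤1 with total 0# 1#
  ... | inj₁ 0≤1 = 0≤1
  ... | inj₂ 1≤0 = subst (0# ≤_) -1²≡1 (*-nonneg 0≤-1 0≤-1)
    where
    0≤-1 : 0# ≤ - 1#
    0≤-1 = subst₂ _≤_ (-‿inverseʳ 1#) (+-identityˡ (- 1#)) (+-mono-≤ (- 1#) 1≤0)
    -1²≡1 : (- 1#) * (- 1#) ≡ 1#
    -1²≡1 = begin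
      (- 1#) * (- 1#)                         ≡⟨ sym (+-identityʳ _) ⟩
      (- 1#) * (- 1#) + 0#                    ≡⟨ cong ((- 1#) * (- 1#) +_) (sym (-‿inverseˡ 1#)) ⟩
      (- 1#) * (- 1#) + ((- 1#) + 1#)         ≡⟨ cong (λ z → (- 1#) * (- 1#) + (z + 1#)) (sym (*-identityʳ _)) ⟩
      (- 1#) * (- 1#) + ((- 1#) * 1# + 1#)    ≡⟨ solve 2 (λ m o → (m ⊗ m ⊕ (m ⊗ o ⊕ o)) ⊜ (m ⊗ (m ⊕ o) ⊕ o)) refl (- 1#) 1# ⟩
      (- 1#) * (- 1# + 1#) + 1#               ≡⟨ cong (λ z → (- 1#) * z + 1#) (-‿inverseˡ 1#) ⟩
      (- 1#) * 0# + 1#                        ≡⟨ cong (_+ 1#) (zeroʳ _) ⟩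
      0# + 1#                                 ≡⟨ +-identityˡ 1# ⟩
      1#                                      ∎

  1≤1+fromℕ′ : ∀ n → 1# ≤ 1# + fromℕ′ n
  0≤fromℕ′ : ∀ n → 0# ≤ fromℕ′ n

  1≤1+fromℕ′ n = subst₂ _≤_ (+-identityˡ 1#) (+-comm (fromℕ′ n) 1#) (+-mono-≤ 1# (0≤fromℕ′ n))

  0≤fromℕ′ zero    = ≤-refl
  0≤fromℕ′ (suc n) = ≤-trans 0≤1 (1≤1+fromℕ′ n)

  fromℕ′-suc≢0 : ∀ n → ¬ (fromℕ′ (suc n) ≡ 0#)
  fromℕ′-suc≢0 n 1+n≡0 = 0≢1 (antisym 0≤1 (subst (1# ≤_) 1+n≡0 (1≤1+fromℕ′ n)))

  fromℕ′-+ : ∀ m n → fromℕ′ (m ℕ.+ n) ≡ fromℕ′ m + fromℕ′ n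
  fromℕ′-+ zero    n = sym (+-identityˡ _)
  fromℕ′-+ (suc m) n = trans (cong (λ k → 1# + k) (fromℕ′-+ m n)) (sym (+-assoc _ _ _))

  fromℕ′-* : ∀ m n → fromℕ′ (m ℕ.* n) ≡ fromℕ′ m * fromℕ′ n
  fromℕ′-* zero    n = sym (zeroˡ _)
  fromℕ′-* (suc m) n = begin
    fromℕ′ (n ℕ.+ m ℕ.* n)                   ≡⟨ fromℕ′-+ n (m ℕ.* n) ⟩
    fromℕ′ n + fromℕ′ (m ℕ.* n)              ≡⟨ cong₂ _+_ (sym (*-identityˡ _)) (fromℕ′-* m n) ⟩
    1# * fromℕ′ n + fromℕ′ m * fromℕ′ n      ≡⟨ sym (distribʳ _ _ _) ⟩
    (1# + fromℕ′ m) * fromℕ′ n               ∎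

  fromℚ-≃ : ∀ {p} → 0ℚ ℚ.≤ p → ∀ n k → ℚ.toℚᵘ p ℚᵘ.≃ mkℚᵘ (ℤ.+ n) k →
            fromℚ p ≡ fromℕ′ n * fromℕ′ (suc k) ⁻¹
  fromℚ-≃ {mkℚ -[1+ m ] _ _} 0≤p = ⊥-elim (0≰-[1+ m ] refl 0≤p)
  fromℚ-≃ {mkℚ (ℤ.+ m) d _} _ n k (*≡* m[1+k]≡n[1+d]) =
    ÷-cong (fromℕ′-suc≢0 d) (fromℕ′-suc≢0 k) (begin
      fromℕ′ m * fromℕ′ (suc k)   ≡⟨ sym (fromℕ′-* m (suc k)) ⟩
      fromℕ′ (m ℕ.* suc k)        ≡⟨ cong fromℕ′ (ℤ.+-injective (begin
        ℤ.+ (m ℕ.* suc k)             ≡⟨ ℤ.pos-* m (suc k) ⟩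
        ℤ.+ m ℤ.* ℤ.+ suc k           ≡⟨ m[1+k]≡n[1+d] ⟩
        ℤ.+ n ℤ.* ℤ.+ suc d           ≡⟨ ℤ.pos-* n (suc d) ⟨
        ℤ.+ (n ℕ.* suc d)             ∎)) ⟩
      fromℕ′ (n ℕ.* suc d)        ≡⟨ fromℕ′-* n (suc d) ⟩
      fromℕ′ n * fromℕ′ (suc d)   ∎)

  fromℚ-+ : ∀ {p q} → 0ℚ ℚ.≤ p → 0ℚ ℚ.≤ q → fromℚ (p ℚ.+ q) ≡ fromℚ p + fromℚ q
  fromℚ-+ {mkℚ -[1+ m ] _ _} 0≤p 0≤q = ⊥-elim (0≰-[1+ m ] refl 0≤p)
  fromℚ-+ {mkℚ (ℤ.+ _) _ _} {mkℚ -[1+ m ] _ _} 0≤p 0≤q = ⊥-elim (0≰-[1+ m ] refl 0≤q)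
  fromℚ-+ {p@(mkℚ (ℤ.+ n₁) d₁ _)} {q@(mkℚ (ℤ.+ n₂) d₂ _)} 0≤p 0≤q = begin
    fromℚ (p ℚ.+ q)
      ≡⟨ fromℚ-≃ (0≤-+ 0≤p 0≤q) _ _ (ℚᵘ.≃-trans (ℚ.toℚᵘ-homo-+ p q) (ℚᵘ.≃-reflexive numerator≡)) ⟩
    fromℕ′ (n₁ ℕ.* suc d₂ ℕ.+ n₂ ℕ.* suc d₁) * fromℕ′ (suc d₁ ℕ.* suc d₂) ⁻¹
      ≡⟨ cong₂ (λ x y → x * y ⁻¹)
               (trans (fromℕ′-+ (n₁ ℕ.* suc d₂) (n₂ ℕ.* suc d₁)) (cong₂ _+_ (fromℕ′-* n₁ (suc d₂)) (fromℕ′-* n₂ (suc d₁))))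
               (fromℕ′-* (suc d₁) (suc d₂)) ⟩
    (N₁ * S₂ + N₂ * S₁) * (S₁ * S₂) ⁻¹
      ≡⟨ ÷-+ (fromℕ′-suc≢0 d₁) (fromℕ′-suc≢0 d₂) ⟩
    N₁ * S₁ ⁻¹ + N₂ * S₂ ⁻¹ ∎
    where
    N₁ = fromℕ′ n₁
    N₂ = fromℕ′ n₂
    S₁ = fromℕ′ (suc d₁)
    S₂ = fromℕ′ (suc d₂)
    numerator≡ : ℚ.toℚᵘ p ℚᵘ.+ ℚ.toℚᵘ q ≡ mkℚᵘ (ℤ.+ (n₁ ℕ.* suc d₂ ℕ.+ n₂ ℕ.* suc d₁)) (d₂ ℕ.+ d₁ ℕ.* suc d₂)
    numerator≡ = cong (λ z → mkℚᵘ z _) (sym (begin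
      ℤ.+ (n₁ ℕ.* suc d₂ ℕ.+ n₂ ℕ.* suc d₁)           ≡⟨ ℤ.pos-+ (n₁ ℕ.* suc d₂) (n₂ ℕ.* suc d₁) ⟩
      ℤ.+ (n₁ ℕ.* suc d₂) ℤ.+ ℤ.+ (n₂ ℕ.* suc d₁)     ≡⟨ cong₂ ℤ._+_ (ℤ.pos-* n₁ (suc d₂)) (ℤ.pos-* n₂ (suc d₁)) ⟩
      ℤ.+ n₁ ℤ.* ℤ.+ suc d₂ ℤ.+ ℤ.+ n₂ ℤ.* ℤ.+ suc d₁ ∎))

  fromℚ-* : ∀ {p q} → 0ℚ ℚ.≤ p → 0ℚ ℚ.≤ q → fromℚ (p ℚ.* q) ≡ fromℚ p * fromℚ q
  fromℚ-* {mkℚ -[1+ m ] _ _} 0≤p 0≤q = ⊥-elim (0≰-[1+ m ] refl 0≤p)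
  fromℚ-* {mkℚ (ℤ.+ _) _ _} {mkℚ -[1+ m ] _ _} 0≤p 0≤q = ⊥-elim (0≰-[1+ m ] refl 0≤q)
  fromℚ-* {p@(mkℚ (ℤ.+ n₁) d₁ _)} {q@(mkℚ (ℤ.+ n₂) d₂ _)} 0≤p 0≤q = begin
    fromℚ (p ℚ.* q)
      ≡⟨ fromℚ-≃ (0≤-* 0≤p 0≤q) _ _ (ℚᵘ.≃-trans (ℚ.toℚᵘ-homo-* p q) (ℚᵘ.≃-reflexive numerator≡)) ⟩
    fromℕ′ (n₁ ℕ.* n₂) * fromℕ′ (suc d₁ ℕ.* suc d₂) ⁻¹
      ≡⟨ cong₂ (λ x y → x * y ⁻¹) (fromℕ′-* n₁ n₂) (fromℕ′-* (suc d₁) (suc d₂)) ⟩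
    (fromℕ′ n₁ * fromℕ′ n₂) * (fromℕ′ (suc d₁) * fromℕ′ (suc d₂)) ⁻¹
      ≡⟨ ÷-* (fromℕ′-suc≢0 d₁) (fromℕ′-suc≢0 d₂) ⟩
    fromℚ p * fromℚ q ∎
    where
    numerator≡ : ℚ.toℚᵘ p ℚᵘ.* ℚ.toℚᵘ q ≡ mkℚᵘ (ℤ.+ (n₁ ℕ.* n₂)) (d₂ ℕ.+ d₁ ℕ.* suc d₂)
    numerator≡ = cong (λ z → mkℚᵘ z _) (sym (ℤ.pos-* n₁ n₂))

  fromℚ-ℕ→ℚ : ∀ y → fromℚ (ℕ→ℚ y) ≡ fromℕ′ y
  fromℚ-ℕ→ℚ y = begin
    fromℕ′ y * (1# + 0#) ⁻¹   ≡⟨ cong (λ z → fromℕ′ y * z ⁻¹) (+-identityʳ 1#) ⟩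
    fromℕ′ y * 1# ⁻¹          ≡⟨ cong (fromℕ′ y *_) 1⁻¹ ⟩
    fromℕ′ y * 1#             ≡⟨ *-identityʳ _ ⟩
    fromℕ′ y                  ∎

  fromℚ-0 : fromℚ 0ℚ ≡ 0#
  fromℚ-0 = zeroˡ _

  Σ-cong : ∀ {n} {f g : Fin n → Carrier} → (∀ i → f i ≡ g i) → Σ[ f ] ≡ Σ[ g ]
  Σ-cong {zero}  f≗g = refl
  Σ-cong {suc n} f≗g = cong₂ _+_ (f≗g Fin.zero) (Σ-cong (λ i → f≗g (Fin.suc i)))

  Σ-+ : ∀ {n} (f g : Fin n → Carrier) → Σ[ (λ i → f i + g i) ] ≡ Σ[ f ] + Σ[ g ]
  Σ-+ {zero}  f g = sym (+-identityˡ 0#)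
  Σ-+ {suc n} f g = trans (cong ((f Fin.zero + g Fin.zero) +_) (Σ-+ (λ i → f (Fin.suc i)) (λ i → g (Fin.suc i))))
    (solve 4 (λ a b c d → ((a ⊕ b) ⊕ (c ⊕ d)) ⊜ ((a ⊕ c) ⊕ (b ⊕ d))) refl _ _ _ _)

  Σ-*ˡ : ∀ {n} c (f : Fin n → Carrier) → Σ[ (λ i → c * f i) ] ≡ c * Σ[ f ]
  Σ-*ˡ {zero}  c f = sym (zeroʳ c)
  Σ-*ˡ {suc n} c f = trans (cong (c * f Fin.zero +_) (Σ-*ˡ c (λ i → f (Fin.suc i)))) (sym (distribˡ _ _ _))

  Σ-*-snoc : ∀ {n} (α : Fin n → Carrier) a (c : Fin (suc n) → Carrier) →
             Σ[ (λ j → c j * snoc α a j) ] ≡ Σ[ (λ i → c (inject₁ i) * α i) ] + c (fromℕ n) * a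
  Σ-*-snoc {zero}  α a c = +-comm _ _
  Σ-*-snoc {suc n} α a c =
    trans (cong (c Fin.zero * α Fin.zero +_) (Σ-*-snoc (λ i → α (Fin.suc i)) a (λ j → c (Fin.suc j))))
          (sym (+-assoc _ _ _))

  Σ-*-snoc-substitute : ∀ {n} {α : Fin n → Carrier} {a} (e : Fin n → Carrier) →
    a ≡ Σ[ (λ i → e i * α i) ] → (c : Fin (suc n) → Carrier) →
    Σ[ (λ j → c j * snoc α a j) ] ≡ Σ[ (λ i → (c (inject₁ i) + c (fromℕ n) * e i) * α i) ]
  Σ-*-snoc-substitute {n} {α} {a} e a≡ c = begin
    Σ[ (λ j → c j * snoc α a j) ]                                ≡⟨ Σ-*-snoc α a c ⟩
    Σ[ (λ i → c (inject₁ i) * α i) ] + cₙ * a                    ≡⟨ cong (Σ[ (λ i → c (inject₁ i) * α i) ] +_)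
                                                                         (trans (cong (cₙ *_) a≡) (sym (Σ-*ˡ cₙ (λ i → e i * α i)))) ⟩
    Σ[ (λ i → c (inject₁ i) * α i) ] + Σ[ (λ i → cₙ * (e i * α i)) ] ≡⟨ sym (Σ-+ (λ i → c (inject₁ i) * α i) (λ i → cₙ * (e i * α i))) ⟩
    Σ[ (λ i → c (inject₁ i) * α i + cₙ * (e i * α i)) ]          ≡⟨ Σ-cong (λ i → distrib (c (inject₁ i)) cₙ (e i) (α i)) ⟩
    Σ[ (λ i → (c (inject₁ i) + cₙ * e i) * α i) ]                ∎
    where
    cₙ = c (fromℕ n)
    distrib : ∀ x y z u → x * u + y * (z * u) ≡ (x + y * z) * u
    distrib x y z u = solve 4 (λ x u y z → (x ⊗ u ⊕ y ⊗ (z ⊗ u)) ⊜ ((x ⊕ y ⊗ z) ⊗ u)) refl x u y z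

  Σ-*-snoc-pad : ∀ {S : Set} {n} (α : Fin n → Carrier) a (φ : S → Carrier) (x : Fin n → S) s →
    φ s ≡ 0# → Σ[ (λ j → φ (snoc x s j) * snoc α a j) ] ≡ Σ[ (λ i → φ (x i) * α i) ]
  Σ-*-snoc-pad {n = n} α a φ x s φs≡0 = begin
    Σ[ (λ j → φ (snoc x s j) * snoc α a j) ]                                  ≡⟨ Σ-*-snoc α a (λ j → φ (snoc x s j)) ⟩
    Σ[ (λ i → φ (snoc x s (inject₁ i)) * α i) ] + φ (snoc x s (fromℕ n)) * a
      ≡⟨ cong₂ _+_ (Σ-cong (λ i → cong (λ z → φ z * α i) (snoc-inject₁ x s i)))
                   (trans (cong (λ z → φ z * a) (snoc-last x s)) (trans (cong (_* a) φs≡0) (zeroˡ a))) ⟩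
    Σ[ (λ i → φ (x i) * α i) ] + 0#                                           ≡⟨ +-identityʳ _ ⟩
    Σ[ (λ i → φ (x i) * α i) ]                                                ∎

module _ (K : RealNumberField) where
  open RealNumberField K
  open OrderedFieldProperties orderedField
  open ≡-Reasoning

  InSG⇒InCone : ∀ {k} {γ : Fin k → Carrier} {w} → InSG K γ w → InCone K γ w
  InSG⇒InCone {γ = γ} (x , w≡) =
    (λ i → ℕ→ℚ (x i)) , (λ i → 0≤ℕ→ℚ (x i)) ,
    trans w≡ (Σ-cong (λ i → cong (_* γ i) (sym (fromℚ-ℕ→ℚ (x i)))))

  InSG-snoc : ∀ {n} {α : Fin n → Carrier} {a} → InSG K α a → ∀ w → InSG K (snoc α a) w ⇔ InSG K α w
  InSG-snoc {n} {α} {a} (y , a≡) w = mk⇔ to from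
    where
    to : InSG K (snoc α a) w → InSG K α w
    to (x , w≡) = (λ i → x (inject₁ i) ℕ.+ x (fromℕ n) ℕ.* y i) , (begin
      w                                                                  ≡⟨ w≡ ⟩
      Σ[ (λ j → fromℕ′ (x j) * snoc α a j) ]                             ≡⟨ Σ-*-snoc-substitute (λ i → fromℕ′ (y i)) a≡ (λ j → fromℕ′ (x j)) ⟩
      Σ[ (λ i → (fromℕ′ (x (inject₁ i)) + fromℕ′ (x (fromℕ n)) * fromℕ′ (y i)) * α i) ]
        ≡⟨ Σ-cong (λ i → cong (_* α i) (sym (fromℕ′-coefficient i))) ⟩
      Σ[ (λ i → fromℕ′ (x (inject₁ i) ℕ.+ x (fromℕ n) ℕ.* y i) * α i) ] ∎)
      where
      fromℕ′-coefficient : ∀ i → fromℕ′ (x (inject₁ i) ℕ.+ x (fromℕ n) ℕ.* y i) ≡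
                                 fromℕ′ (x (inject₁ i)) + fromℕ′ (x (fromℕ n)) * fromℕ′ (y i)
      fromℕ′-coefficient i = trans (fromℕ′-+ (x (inject₁ i)) (x (fromℕ n) ℕ.* y i))
                                   (cong (fromℕ′ (x (inject₁ i)) +_) (fromℕ′-* (x (fromℕ n)) (y i)))
    from : InSG K α w → InSG K (snoc α a) w
    from (x , w≡) = snoc x 0 , trans w≡ (sym (Σ-*-snoc-pad α a fromℕ′ x 0 refl))

  InCone-snoc : ∀ {n} {α : Fin n → Carrier} {a} → InCone K α a → ∀ v → InCone K (snoc α a) v ⇔ InCone K α v
  InCone-snoc {n} {α} {a} (r , 0≤r , a≡) v = mk⇔ to from
    where
    to : InCone K (snoc α a) v → InCone K α v
    to (q , 0≤q , v≡) = (λ i → q (inject₁ i) ℚ.+ qₙ ℚ.* r i) , 0≤coefficient , (begin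
      v                                                                  ≡⟨ v≡ ⟩
      Σ[ (λ j → fromℚ (q j) * snoc α a j) ]                              ≡⟨ Σ-*-snoc-substitute (λ i → fromℚ (r i)) a≡ (λ j → fromℚ (q j)) ⟩
      Σ[ (λ i → (fromℚ (q (inject₁ i)) + fromℚ qₙ * fromℚ (r i)) * α i) ] ≡⟨ Σ-cong (λ i → cong (_* α i) (sym (fromℚ-coefficient i))) ⟩
      Σ[ (λ i → fromℚ (q (inject₁ i) ℚ.+ qₙ ℚ.* r i) * α i) ]            ∎)
      where
      qₙ = q (fromℕ n)
      0≤coefficient : ∀ i → 0ℚ ℚ.≤ q (inject₁ i) ℚ.+ qₙ ℚ.* r i
      0≤coefficient i = 0≤-+ (0≤q (inject₁ i)) (0≤-* (0≤q (fromℕ n)) (0≤r i))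
      fromℚ-coefficient : ∀ i → fromℚ (q (inject₁ i) ℚ.+ qₙ ℚ.* r i) ≡ fromℚ (q (inject₁ i)) + fromℚ qₙ * fromℚ (r i)
      fromℚ-coefficient i = trans (fromℚ-+ (0≤q (inject₁ i)) (0≤-* (0≤q (fromℕ n)) (0≤r i)))
                                  (cong (fromℚ (q (inject₁ i)) +_) (fromℚ-* (0≤q (fromℕ n)) (0≤r i)))
    from : InCone K α v → InCone K (snoc α a) v
    from (q , 0≤q , v≡) = snoc q 0ℚ , snoc-all (0ℚ ℚ.≤_) 0≤q ℚ.≤-refl ,
                          trans v≡ (sym (Σ-*-snoc-pad α a fromℚ q 0ℚ fromℚ-0))

  InFrob-cong : ∀ {k m} {γ : Fin k → Carrier} {δ : Fin m → Carrier} →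
                (∀ w → InSG K γ w ⇔ InSG K δ w) → (∀ v → InCone K γ v ⇔ InCone K δ v) →
                ∀ w → InFrob K γ w ⇔ InFrob K δ w
  InFrob-cong SG⇔ Cone⇔ w = mk⇔
    (λ (w∈SG , closed) → to (SG⇔ w) w∈SG , λ v v∈C v∈𝔒 → to (SG⇔ (w + v)) (closed v (from (Cone⇔ v) v∈C) v∈𝔒))
    (λ (w∈SG , closed) → from (SG⇔ w) w∈SG , λ v v∈C v∈𝔒 → from (SG⇔ (w + v)) (closed v (to (Cone⇔ v) v∈C) v∈𝔒))
    where open Equivalence

lemma6 : (K : RealNumberField) → (n : ℕ) → (α : Fin n → RealNumberField.Carrier K) →
    (∀ i → IsIntegral⁺ K (α i)) → GeneratesIntegers K α →
    (a : RealNumberField.Carrier K) → InSG K α a →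
    ∀ w → InFrob K (snoc α a) w ⇔ InFrob K α w
lemma6 K _ α _ _ a a∈SG =
  InFrob-cong K {γ = snoc α a} {δ = α} (InSG-snoc K a∈SG) (InCone-snoc K (InSG⇒InCone K a∈SG))
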